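{- Assume that for every object $X$ of $\mathbf{C}$ a free uniform-iteration algebra $KX$ exists and is stable. Then $\mathbb{K}$ is copyable and weakly discardable: $\hat\tau^*\tau\Delta=K\Delta\colon KX\to K(X\times X)$, and $(K\mathrm{fst})\,\hat\tau^*\,\tau\,\langle f,g\rangle\sqsubseteq f$ for all $f\colon X\to KY$ and $g\colon X\to KZ$.
   Context: $\mathbf{C}$ is an extensive category with finite products, a stable natural number object and exponentials $X^{\mathbb{N}}$. A uniform-iteration algebra is an object $A$ with an operator $f\mapsto f^\dagger$ ($f\colon Z\to A+Z$, $f^\dagger\colon Z\to A$) satisfying (Fixpoint) $f^\dagger=[\mathrm{id},f^\dagger]f$ and (Uniformity) $(\mathrm{id}+h)f=gh\Rightarrow f^\dagger=g^\dagger h$; morphisms $h$ satisfy $hf^\dagger=((h+\mathrm{id})f)^\dagger$. $KX$ with unit $\eta$ is free on $X$; $KY$ is stable if for every $X$, $\mathrm{fst}\colon X\times KY\to X$ with $\mathrm{id}\times\eta$ is a free uniform-iteration algebra over $\mathrm{fst}\colon X\times Y\to X$ in $\mathbf{C}/X$. $\mathbb{K}$ has unit $\eta$ and Kleisli lifting $f^*$ the unique algebra morphism with $f^*\eta=f$; strength $\tau\colon X\times KY\to K(X\times Y)$ is the unique morphism with $\tau(\mathrm{id}\times\eta)=\eta$ and $\tau(\mathrm{id}\times h^\dagger)=((\tau+\mathrm{id})\mathrm{dstr}(\mathrm{id}\times h))^\dagger$; $\hat\tau\colon KX\times Y\to K(X\times Y)$ is the dual strength; $\Delta$ is the diagonal.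 For $f\colon X\to KY$, $g\colon X\to KZ$: $f\downharpoonright g=\mathrm{fst}^*\tau\langle f,g\rangle$, and for $f,f'\colon X\to KY$, $f\sqsubseteq f'$ iff $f=f'\downharpoonright f$. -}

module Defs where

open import Level using (Level; _⊔_) renaming (suc to lsuc)
open import Relation.Binary using (Rel; IsEquivalence)
open import Data.Product using (Σ; _,_; proj₁; proj₂) renaming (_×_ to _∧_)

record Category (o ℓ e : Level) : Set (lsuc (o ⊔ ℓ ⊔ e)) where
  infix  4 _≈_ _⇒_
  infixr 9 _∘_
  field
    Obj       : Set o
    _⇒_       : Obj → Obj → Set ℓ
    _≈_       : ∀ {A B} → Rel (A ⇒ B) e
    id        : ∀ {A} → A ⇒ A
    _∘_       : ∀ {A B C} → B ⇒ C → A ⇒ B → A ⇒ C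
    ≈-equiv   : ∀ {A B} → IsEquivalence (_≈_ {A} {B})
    ∘-resp-≈  : ∀ {A B C} {f f' : B ⇒ C} {g g' : A ⇒ B} →
                f ≈ f' → g ≈ g' → f ∘ g ≈ f' ∘ g'
    assoc     : ∀ {A B C D} {f : A ⇒ B} {g : B ⇒ C} {h : C ⇒ D} →
                (h ∘ g) ∘ f ≈ h ∘ (g ∘ f)
    identityˡ : ∀ {A B} {f : A ⇒ B} → id ∘ f ≈ f
    identityʳ : ∀ {A B} {f : A ⇒ B} → f ∘ id ≈ f

module Theory {o ℓ e : Level} (𝒞 : Category o ℓ e) where
  open Category 𝒞

  record Terminal : Set (o ⊔ ℓ ⊔ e) where
    field
      ⊤        : Obj
      !        : ∀ {A} → A ⇒ ⊤
      !-unique : ∀ {A} (f : A ⇒ ⊤) → f ≈ !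

  record Initial : Set (o ⊔ ℓ ⊔ e) where
    field
      ⊥        : Obj
      ¡        : ∀ {A} → ⊥ ⇒ A
      ¡-unique : ∀ {A} (f : ⊥ ⇒ A) → f ≈ ¡

  record BinaryProducts : Set (o ⊔ ℓ ⊔ e) where
    infixr 7 _×_
    infixr 8 _⁂_
    field
      _×_      : Obj → Obj → Obj
      π₁       : ∀ {A B} → A × B ⇒ A
      π₂       : ∀ {A B} → A × B ⇒ B
      ⟨_,_⟩    : ∀ {A B C} → C ⇒ A → C ⇒ B → C ⇒ A × B
      project₁ : ∀ {A B C} {f : C ⇒ A} {g : C ⇒ B} → π₁ ∘ ⟨ f , g ⟩ ≈ f
      project₂ : ∀ {A B C} {f : C ⇒ A} {g : C ⇒ B} → π₂ ∘ ⟨ f , g ⟩ ≈ g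
      unique   : ∀ {A B C} {h : C ⇒ A × B} {f : C ⇒ A} {g : C ⇒ B} →
                 π₁ ∘ h ≈ f → π₂ ∘ h ≈ g → ⟨ f , g ⟩ ≈ h

    _⁂_ : ∀ {A B C D} → A ⇒ B → C ⇒ D → A × C ⇒ B × D
    f ⁂ g = ⟨ f ∘ π₁ , g ∘ π₂ ⟩

    Δ : ∀ {A} → A ⇒ A × A
    Δ = ⟨ id , id ⟩

    swap : ∀ {A B} → A × B ⇒ B × A
    swap = ⟨ π₂ , π₁ ⟩

  record BinaryCoproducts : Set (o ⊔ ℓ ⊔ e) where
    infixr 6 _+_
    infixr 7 _+₁_
    field
      _+_      : Obj → Obj → Obj
      i₁       : ∀ {A B} → A ⇒ A + B
      i₂       : ∀ {A B} → B ⇒ A + B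
      [_,_]    : ∀ {A B C} → A ⇒ C → B ⇒ C → A + B ⇒ C
      inject₁  : ∀ {A B C} {f : A ⇒ C} {g : B ⇒ C} → [ f , g ] ∘ i₁ ≈ f
      inject₂  : ∀ {A B C} {f : A ⇒ C} {g : B ⇒ C} → [ f , g ] ∘ i₂ ≈ g
      unique   : ∀ {A B C} {h : A + B ⇒ C} {f : A ⇒ C} {g : B ⇒ C} →
                 h ∘ i₁ ≈ f → h ∘ i₂ ≈ g → [ f , g ] ≈ h

    _+₁_ : ∀ {A B C D} → A ⇒ B → C ⇒ D → A + C ⇒ B + D
    f +₁ g = [ i₁ ∘ f , i₂ ∘ g ]

  IsPullback : ∀ {P A B C} → P ⇒ A → P ⇒ B → A ⇒ C → B ⇒ C → Set (o ⊔ ℓ ⊔ e)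
  IsPullback {P} {A} {B} p₁ p₂ f g =
    (f ∘ p₁ ≈ g ∘ p₂) ∧
    (∀ {Q} (h₁ : Q ⇒ A) (h₂ : Q ⇒ B) → f ∘ h₁ ≈ g ∘ h₂ →
      Σ (Q ⇒ P) λ u → ((p₁ ∘ u ≈ h₁) ∧ (p₂ ∘ u ≈ h₂)) ∧
        (∀ (u' : Q ⇒ P) → p₁ ∘ u' ≈ h₁ → p₂ ∘ u' ≈ h₂ → u' ≈ u))

  IsCoproduct : ∀ {X₁ X X₂} → X₁ ⇒ X → X₂ ⇒ X → Set (o ⊔ ℓ ⊔ e)
  IsCoproduct {X₁} {X} {X₂} j₁ j₂ =
    ∀ {Q} (h₁ : X₁ ⇒ Q) (h₂ : X₂ ⇒ Q) →
      Σ (X ⇒ Q) λ u → ((u ∘ j₁ ≈ h₁) ∧ (u ∘ j₂ ≈ h₂)) ∧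
        (∀ (u' : X ⇒ Q) → u' ∘ j₁ ≈ h₁ → u' ∘ j₂ ≈ h₂ → u' ≈ u)

  -- Extensivity (Carboni–Lack–Walters, Prop. 2.2): pullbacks along coproduct
  -- injections exist, and in every commutative diagram
  --      X₁ --j₁--> X <--j₂-- X₂
  --      |a         |f        |b
  --      A  --i₁--> A+B <-i₂-- B
  -- the top row is a coproduct iff both squares are pullbacks.
  record Extensive (I : Initial) (CP : BinaryCoproducts) : Set (o ⊔ ℓ ⊔ e) where
    open BinaryCoproducts CP
    field
      pullback₁ : ∀ {A B C} (f : C ⇒ A + B) →
        Σ Obj λ P → Σ (P ⇒ C) λ p₁ → Σ (P ⇒ A) λ p₂ → IsPullback p₁ p₂ f i₁
      pullback₂ : ∀ {A B C} (f : C ⇒ A + B) →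
        Σ Obj λ P → Σ (P ⇒ C) λ p₁ → Σ (P ⇒ B) λ p₂ → IsPullback p₁ p₂ f i₂
      extensive : ∀ {A B X₁ X X₂} (j₁ : X₁ ⇒ X) (j₂ : X₂ ⇒ X) (f : X ⇒ A + B)
        (a : X₁ ⇒ A) (b : X₂ ⇒ B) → f ∘ j₁ ≈ i₁ ∘ a → f ∘ j₂ ≈ i₂ ∘ b →
        (IsCoproduct j₁ j₂ → IsPullback j₁ a f i₁ ∧ IsPullback j₂ b f i₂) ∧
        (IsPullback j₁ a f i₁ ∧ IsPullback j₂ b f i₂ → IsCoproduct j₁ j₂)

  -- Stable natural number object: for every X, (X × N, ⟨id, z ∘ !⟩, id ⁂ s)
  -- is a natural number object in the slice 𝒞/X.
  record StableNNO (T : Terminal) (P : BinaryProducts) : Set (o ⊔ ℓ ⊔ e) where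
    open Terminal T
    open BinaryProducts P
    field
      N : Obj
      z : ⊤ ⇒ N
      s : N ⇒ N
      universal : ∀ {X A} (p : A ⇒ X) (f : X ⇒ A) (g : A ⇒ A) →
        p ∘ f ≈ id → p ∘ g ≈ p →
        Σ (X × N ⇒ A) λ h →
          ((p ∘ h ≈ π₁) ∧ (h ∘ ⟨ id , z ∘ ! ⟩ ≈ f) ∧ (h ∘ (id ⁂ s) ≈ g ∘ h)) ∧
          (∀ (h' : X × N ⇒ A) → p ∘ h' ≈ π₁ → h' ∘ ⟨ id , z ∘ ! ⟩ ≈ f →
             h' ∘ (id ⁂ s) ≈ g ∘ h' → h' ≈ h)

  record ExponentialsN (P : BinaryProducts) (N : Obj) : Set (o ⊔ ℓ ⊔ e) where
    open BinaryProducts P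
    field
      _^N     : Obj → Obj
      ev      : ∀ {X} → (X ^N) × N ⇒ X
      curry   : ∀ {X Y} → Y × N ⇒ X → Y ⇒ X ^N
      β       : ∀ {X Y} {f : Y × N ⇒ X} → ev ∘ (curry f ⁂ id) ≈ f
      unique  : ∀ {X Y} {f : Y × N ⇒ X} {h : Y ⇒ X ^N} →
                ev ∘ (h ⁂ id) ≈ f → h ≈ curry f

record Setting (o ℓ e : Level) : Set (lsuc (o ⊔ ℓ ⊔ e)) where
  field
    cat        : Category o ℓ e
  open Category cat public
  open Theory cat public
  field
    terminal   : Terminal
    products   : BinaryProducts
    initial    : Initial
    coproducts : BinaryCoproducts
    extensiveC : Extensive initial coproducts
    nno        : StableNNO terminal products
    expN       : ExponentialsN products (StableNNO.N nno)
  open Terminal terminal public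
  open BinaryProducts products public
    renaming (unique to ×-unique)
  open BinaryCoproducts coproducts public
    renaming (unique to +-unique)

module Iteration {o ℓ e : Level} (S : Setting o ℓ e) where
  open Setting S

  record IterationAlgebra (A : Obj) : Set (o ⊔ ℓ ⊔ e) where
    field
      _†         : ∀ {Z} → Z ⇒ A + Z → Z ⇒ A
      fixpoint   : ∀ {Z} {f : Z ⇒ A + Z} → f † ≈ [ id , f † ] ∘ f
      uniformity : ∀ {Z W} {f : Z ⇒ A + Z} {g : W ⇒ A + W} {h : Z ⇒ W} →
                   (id +₁ h) ∘ f ≈ g ∘ h → f † ≈ (g †) ∘ h

  IsAlgMorphism : ∀ {A B} → IterationAlgebra A → IterationAlgebra B → A ⇒ B →
                  Set (o ⊔ ℓ ⊔ e)
  IsAlgMorphism {A} α β h =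
    ∀ {Z} (f : Z ⇒ A + Z) →
      h ∘ IterationAlgebra._† α f ≈ IterationAlgebra._† β ((h +₁ id) ∘ f)

  -- A morphism f : (Z , r) → (A , p) + (Z , r) of 𝒞/X is an f : Z ⇒ A + Z
  -- with [ p , r ] ∘ f ≈ r (coproducts in 𝒞/X are computed as in 𝒞).
  SliceOp : ∀ {X A} → A ⇒ X → Set (o ⊔ ℓ ⊔ e)
  SliceOp {X} {A} p =
    ∀ {Z} (r : Z ⇒ X) (f : Z ⇒ A + Z) → [ p , r ] ∘ f ≈ r → Z ⇒ A

  record IsSliceIterationAlgebra {X A} (p : A ⇒ X) (op : SliceOp p)
      : Set (o ⊔ ℓ ⊔ e) where
    field
      over       : ∀ {Z} {r : Z ⇒ X} {f : Z ⇒ A + Z} (q : [ p , r ] ∘ f ≈ r) →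
                   p ∘ op r f q ≈ r
      fixpoint   : ∀ {Z} {r : Z ⇒ X} {f : Z ⇒ A + Z} (q : [ p , r ] ∘ f ≈ r) →
                   op r f q ≈ [ id , op r f q ] ∘ f
      uniformity : ∀ {Z W} {r : Z ⇒ X} {s : W ⇒ X}
                   {f : Z ⇒ A + Z} {g : W ⇒ A + W} {h : Z ⇒ W}
                   (qf : [ p , r ] ∘ f ≈ r) (qg : [ p , s ] ∘ g ≈ s) →
                   s ∘ h ≈ r → (id +₁ h) ∘ f ≈ g ∘ h →
                   op r f qf ≈ op s g qg ∘ h

  record SliceIterationAlgebra {X A} (p : A ⇒ X) : Set (o ⊔ ℓ ⊔ e) where
    field
      op    : SliceOp p
      isAlg : IsSliceIterationAlgebra p op

  IsSliceAlgMorphism : ∀ {X A B} {p : A ⇒ X} {q : B ⇒ X} →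
    SliceIterationAlgebra p → SliceIterationAlgebra q → A ⇒ B → Set (o ⊔ ℓ ⊔ e)
  IsSliceAlgMorphism {X} {A} {B} {p} {q} α β h =
    (q ∘ h ≈ p) ∧
    (∀ {Z} (r : Z ⇒ X) (f : Z ⇒ A + Z) (qf : [ p , r ] ∘ f ≈ r)
       (qf' : [ q , r ] ∘ ((h +₁ id) ∘ f) ≈ r) →
       h ∘ SliceIterationAlgebra.op α r f qf ≈
       SliceIterationAlgebra.op β r ((h +₁ id) ∘ f) qf')

  inducedOp : ∀ {X A} → IterationAlgebra A → SliceOp (π₁ {X} {A})
  inducedOp α r f _ = ⟨ r , IterationAlgebra._† α ((π₂ +₁ id) ∘ f) ⟩

  record FreeIterationAlgebra (X : Obj) : Set (o ⊔ ℓ ⊔ e) where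
    field
      KX   : Obj
      η    : X ⇒ KX
      alg  : IterationAlgebra KX
      free : ∀ {B} (β : IterationAlgebra B) (g : X ⇒ B) →
        Σ (KX ⇒ B) λ h → (IsAlgMorphism alg β h ∧ (h ∘ η ≈ g)) ∧
          (∀ (h' : KX ⇒ B) → IsAlgMorphism alg β h' → h' ∘ η ≈ g → h' ≈ h)

  record IsStable {Y : Obj} (F : FreeIterationAlgebra Y) : Set (o ⊔ ℓ ⊔ e) where
    open FreeIterationAlgebra F
    field
      inducedIsAlg : ∀ {X} → IsSliceIterationAlgebra (π₁ {X} {KX}) (inducedOp alg)

    inducedAlg : ∀ {X} → SliceIterationAlgebra (π₁ {X} {KX})
    inducedAlg = record { op = inducedOp alg ; isAlg = inducedIsAlg }

    field
      stableFree : ∀ {X B} {q : B ⇒ X} (β : SliceIterationAlgebra q)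
        (g : X × Y ⇒ B) → q ∘ g ≈ π₁ →
        Σ (X × KX ⇒ B) λ h →
          (IsSliceAlgMorphism inducedAlg β h ∧ (h ∘ (id ⁂ η) ≈ g)) ∧
          (∀ (h' : X × KX ⇒ B) → IsSliceAlgMorphism inducedAlg β h' →
             h' ∘ (id ⁂ η) ≈ g → h' ≈ h)

  record StableFreeIteration : Set (o ⊔ ℓ ⊔ e) where
    field
      freeAlg : (X : Obj) → FreeIterationAlgebra X
      stable  : (X : Obj) → IsStable (freeAlg X)

module Monad {o ℓ e : Level} (S : Setting o ℓ e)
             (H : Iteration.StableFreeIteration S) where
  open Setting S
  open Iteration S
  open StableFreeIteration H

  K : Obj → Obj
  K X = FreeIterationAlgebra.KX (freeAlg X)

  η : ∀ {X} → X ⇒ K X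
  η {X} = FreeIterationAlgebra.η (freeAlg X)

  algK : ∀ {X} → IterationAlgebra (K X)
  algK {X} = FreeIterationAlgebra.alg (freeAlg X)

  _* : ∀ {X Y} → X ⇒ K Y → K X ⇒ K Y
  _* {X} {Y} f = proj₁ (FreeIterationAlgebra.free (freeAlg X) algK f)

  K₁ : ∀ {X Y} → X ⇒ Y → K X ⇒ K Y
  K₁ f = (η ∘ f) *

  -- strength τ : A × KB ⇒ K(A × B): τ = π₂ ∘ h, where h is the unique
  -- algebra morphism (A × KB , π₁) → (A × K(A × B) , π₁) in 𝒞/A with
  -- h ∘ (id ⁂ η) ≈ ⟨ π₁ , η ⟩ (equivalently τ ∘ (id ⁂ η) ≈ η and τ
  -- commutes with iteration as in the characterisation of τ).
  τ : ∀ {A B} → A × K B ⇒ K (A × B)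
  τ {A} {B} = π₂ ∘ proj₁ (IsStable.stableFree (stable B)
                 (IsStable.inducedAlg (stable (A × B))) ⟨ π₁ , η ⟩ project₁)

  τ̂ : ∀ {A B} → K A × B ⇒ K (A × B)
  τ̂ = K₁ swap ∘ τ ∘ swap

  infixl 5 _↓_
  _↓_ : ∀ {X Y Z} → X ⇒ K Y → X ⇒ K Z → X ⇒ K Y
  f ↓ g = (π₁ *) ∘ τ ∘ ⟨ f , g ⟩

  infix 4 _⊑_
  _⊑_ : ∀ {X Y} → X ⇒ K Y → X ⇒ K Y → Set e
  f ⊑ f' = f ≈ (f' ↓ f)

-- Stability characterises the strength: a map u : A × K B ⇒ K C that commutes with iteration
-- in its second argument is determined by u ∘ (id ⁂ η).  This gives the equational lifting
-- law τ ∘ Δ ≈ K₁ ⟨ η , id ⟩ (both sides are algebra morphisms agreeing on η), and copyability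
-- follows from it together with τ̂ ∘ (η ⁂ id) ≈ η.  For weak discardability, K₁ π₁ ∘ τ̂ * ∘ τ
-- equals π₁ * ∘ τ, so the left-hand side is f ↓ g; and f ↓ g ⊑ f is the instance at ⟨ f , g ⟩
-- of π₁ * ∘ τ ≈ π₁ ↓ (π₁ * ∘ τ), an identity between iteration-preserving maps that holds on
-- id ⁂ η by equational lifting.
module Submission where

open import Defs
open import Data.Product using (_,_; proj₁; proj₂) renaming (_×_ to _∧_)
open import Level using (_⊔_)
open import Relation.Binary using (Setoid; IsEquivalence)
import Relation.Binary.Reasoning.Setoid as SetoidReasoning

module HomReasoning {o ℓ e} (𝒞 : Category o ℓ e) where
  open Category 𝒞

  hom-setoid : ∀ {A B} → Setoid ℓ e
  hom-setoid {A} {B} = record { Carrier = A ⇒ B ; _≈_ = _≈_ ; isEquivalence = ≈-equiv }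

  module _ {A B : Obj} where
    open IsEquivalence (≈-equiv {A} {B}) public
      renaming (refl to ≈-refl; sym to ≈-sym; trans to ≈-trans)
    open SetoidReasoning (hom-setoid {A} {B}) public

  infixr 4 _⟩∘⟨_ refl⟩∘⟨_
  infixl 5 _⟩∘⟨refl

  _⟩∘⟨_ : ∀ {A B C} {f f' : B ⇒ C} {g g' : A ⇒ B} → f ≈ f' → g ≈ g' → f ∘ g ≈ f' ∘ g'
  _⟩∘⟨_ = ∘-resp-≈

  refl⟩∘⟨_ : ∀ {A B C} {f : B ⇒ C} {g g' : A ⇒ B} → g ≈ g' → f ∘ g ≈ f ∘ g'
  refl⟩∘⟨ p = ≈-refl ⟩∘⟨ p

  _⟩∘⟨refl : ∀ {A B C} {f f' : B ⇒ C} {g : A ⇒ B} → f ≈ f' → f ∘ g ≈ f' ∘ g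
  p ⟩∘⟨refl = p ⟩∘⟨ ≈-refl

  sym-assoc : ∀ {A B C D} {f : A ⇒ B} {g : B ⇒ C} {h : C ⇒ D} → h ∘ (g ∘ f) ≈ (h ∘ g) ∘ f
  sym-assoc = ≈-sym assoc

module ProductLaws {o ℓ e} {𝒞 : Category o ℓ e} (P : Theory.BinaryProducts 𝒞) where
  open Category 𝒞
  open Theory.BinaryProducts P
  open HomReasoning 𝒞

  ⟨⟩-cong : ∀ {A B C} {f f' : C ⇒ A} {g g' : C ⇒ B} → f ≈ f' → g ≈ g' → ⟨ f , g ⟩ ≈ ⟨ f' , g' ⟩
  ⟨⟩-cong p q = ≈-sym (unique (≈-trans project₁ p) (≈-trans project₂ q))

  ⟨⟩∘ : ∀ {A B C D} {f : C ⇒ A} {g : C ⇒ B} {h : D ⇒ C} → ⟨ f , g ⟩ ∘ h ≈ ⟨ f ∘ h , g ∘ h ⟩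
  ⟨⟩∘ = ≈-sym (unique (≈-trans sym-assoc (project₁ ⟩∘⟨refl)) (≈-trans sym-assoc (project₂ ⟩∘⟨refl)))

  ⁂∘⟨⟩ : ∀ {A B C D E} {f : A ⇒ B} {g : C ⇒ D} {a : E ⇒ A} {b : E ⇒ C} →
         (f ⁂ g) ∘ ⟨ a , b ⟩ ≈ ⟨ f ∘ a , g ∘ b ⟩
  ⁂∘⟨⟩ = ≈-trans ⟨⟩∘ (⟨⟩-cong (≈-trans assoc (refl⟩∘⟨ project₁)) (≈-trans assoc (refl⟩∘⟨ project₂)))

  Δ∘ : ∀ {A B} {h : A ⇒ B} → Δ ∘ h ≈ ⟨ h , h ⟩
  Δ∘ = ≈-trans ⟨⟩∘ (⟨⟩-cong identityˡ identityˡ)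

  ⁂∘Δ : ∀ {A B C} {f : A ⇒ B} {g : A ⇒ C} → (f ⁂ g) ∘ Δ ≈ ⟨ f , g ⟩
  ⁂∘Δ = ≈-trans ⁂∘⟨⟩ (⟨⟩-cong identityʳ identityʳ)

  swap∘⟨⟩ : ∀ {A B C} {a : C ⇒ A} {b : C ⇒ B} → swap ∘ ⟨ a , b ⟩ ≈ ⟨ b , a ⟩
  swap∘⟨⟩ = ≈-trans ⟨⟩∘ (⟨⟩-cong project₂ project₁)

  swap∘⁂ : ∀ {A B C D} {f : A ⇒ B} {g : C ⇒ D} → swap ∘ (f ⁂ g) ≈ (g ⁂ f) ∘ swap
  swap∘⁂ = ≈-trans swap∘⟨⟩ (≈-sym ⁂∘⟨⟩)

  swap∘swap : ∀ {A B} → swap ∘ swap ≈ id {A × B}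
  swap∘swap = ≈-trans swap∘⟨⟩ (unique identityʳ identityʳ)

module CoproductLaws {o ℓ e} {𝒞 : Category o ℓ e} (CP : Theory.BinaryCoproducts 𝒞) where
  open Category 𝒞
  open Theory.BinaryCoproducts CP
  open HomReasoning 𝒞

  []-cong : ∀ {A B C} {f f' : A ⇒ C} {g g' : B ⇒ C} → f ≈ f' → g ≈ g' → [ f , g ] ≈ [ f' , g' ]
  []-cong p q = ≈-sym (unique (≈-trans inject₁ p) (≈-trans inject₂ q))

  +₁-cong : ∀ {A B C D} {a a' : A ⇒ B} {b b' : C ⇒ D} → a ≈ a' → b ≈ b' → a +₁ b ≈ a' +₁ b'
  +₁-cong p q = []-cong (refl⟩∘⟨ p) (refl⟩∘⟨ q)

  []∘+₁ : ∀ {A B C D E} {f : B ⇒ E} {g : D ⇒ E} {a : A ⇒ B} {b : C ⇒ D} →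
          [ f , g ] ∘ (a +₁ b) ≈ [ f ∘ a , g ∘ b ]
  []∘+₁ = ≈-sym (unique
    (≈-trans assoc (≈-trans (refl⟩∘⟨ inject₁) (≈-trans sym-assoc (inject₁ ⟩∘⟨refl))))
    (≈-trans assoc (≈-trans (refl⟩∘⟨ inject₂) (≈-trans sym-assoc (inject₂ ⟩∘⟨refl)))))

  +₁∘+₁ : ∀ {A B C D E F} {a : B ⇒ C} {b : E ⇒ F} {c : A ⇒ B} {d : D ⇒ E} →
          (a +₁ b) ∘ (c +₁ d) ≈ (a ∘ c) +₁ (b ∘ d)
  +₁∘+₁ = ≈-trans []∘+₁ ([]-cong assoc assoc)

  +₁id∘+₁id : ∀ {A B C D E} {a : B ⇒ C} {b : A ⇒ B} {f : E ⇒ A + D} →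
              (a +₁ id) ∘ ((b +₁ id) ∘ f) ≈ (a ∘ b +₁ id) ∘ f
  +₁id∘+₁id = ≈-trans sym-assoc (≈-trans +₁∘+₁ (+₁-cong ≈-refl identityˡ) ⟩∘⟨refl)

  over-+₁id : ∀ {X A A' Z} {m : A ⇒ A'} {p : A ⇒ X} {p' : A' ⇒ X} {r : Z ⇒ X} {f : Z ⇒ A + Z} →
              p' ∘ m ≈ p → [ p , r ] ∘ f ≈ r → [ p' , r ] ∘ (m +₁ id) ∘ f ≈ r
  over-+₁id p'∘m≈p f-over =
    ≈-trans sym-assoc (≈-trans (≈-trans []∘+₁ ([]-cong p'∘m≈p identityʳ) ⟩∘⟨refl) f-over)

  id+₁id : ∀ {A B} → id {A} +₁ id {B} ≈ id
  id+₁id = unique (≈-trans identityˡ (≈-sym identityʳ)) (≈-trans identityˡ (≈-sym identityʳ))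

module IterationLaws {o ℓ e} (S : Setting o ℓ e) where
  open Setting S
  open Iteration S
  open HomReasoning cat
  open CoproductLaws coproducts

  module _ {A} (α : IterationAlgebra A) where
    open IterationAlgebra α

    †-cong : ∀ {Z} {f g : Z ⇒ A + Z} → f ≈ g → f † ≈ g †
    †-cong {f = f} {g} f≈g = ≈-trans (uniformity (begin
      (id +₁ id) ∘ f ≈⟨ id+₁id ⟩∘⟨ f≈g ⟩
      id ∘ g         ≈⟨ identityˡ ⟩
      g              ≈⟨ identityʳ ⟨
      g ∘ id         ∎)) identityʳ

    id-isAlgMorphism : IsAlgMorphism α α id
    id-isAlgMorphism f = ≈-trans identityˡ (†-cong (≈-sym (≈-trans (id+₁id ⟩∘⟨refl) identityˡ)))

  ∘-isAlgMorphism : ∀ {A B C} {α : IterationAlgebra A} {β : IterationAlgebra B}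
    {γ : IterationAlgebra C} {k : B ⇒ C} {h : A ⇒ B} →
    IsAlgMorphism β γ k → IsAlgMorphism α β h → IsAlgMorphism α γ (k ∘ h)
  ∘-isAlgMorphism {α = α} {β} {γ} {k} {h} k-mor h-mor f = begin
    (k ∘ h) ∘ iterate α f                  ≈⟨ assoc ⟩
    k ∘ h ∘ iterate α f                    ≈⟨ refl⟩∘⟨ h-mor f ⟩
    k ∘ iterate β ((h +₁ id) ∘ f)          ≈⟨ k-mor _ ⟩
    iterate γ ((k +₁ id) ∘ (h +₁ id) ∘ f)  ≈⟨ †-cong γ +₁id∘+₁id ⟩
    iterate γ ((k ∘ h +₁ id) ∘ f)          ∎
    where open IterationAlgebra renaming (_† to iterate)

module MonadProperties {o ℓ e} (S : Setting o ℓ e) (H : Iteration.StableFreeIteration S) where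
  open Setting S
  open Iteration S
  open Iteration.StableFreeIteration H
  open Monad S H
  open HomReasoning cat
  open ProductLaws products
  open CoproductLaws coproducts
  open IterationLaws S

  infix 10 _†
  _† : ∀ {X Z} → Z ⇒ K X + Z → Z ⇒ K X
  _† = IterationAlgebra._† algK

  IsKAlgMorphism : ∀ {X Y} → K X ⇒ K Y → Set (o ⊔ ℓ ⊔ e)
  IsKAlgMorphism = IsAlgMorphism algK algK

  module _ {X Y : Obj} (f : X ⇒ K Y) where
    private
      free = FreeIterationAlgebra.free (freeAlg X) algK f

    *-isAlgMorphism : IsKAlgMorphism (f *)
    *-isAlgMorphism = proj₁ (proj₁ (proj₂ free))

    *∘η : f * ∘ η ≈ f
    *∘η = proj₂ (proj₁ (proj₂ free))

    *-unique : ∀ {h} → IsKAlgMorphism h → h ∘ η ≈ f → h ≈ f *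
    *-unique {h} = proj₂ (proj₂ free) h

  *-cong : ∀ {X Y} {f g : X ⇒ K Y} → f ≈ g → f * ≈ g *
  *-cong {f = f} {g} f≈g = *-unique g (*-isAlgMorphism f) (≈-trans (*∘η f) f≈g)

  η* : ∀ {X} → η {X} * ≈ id
  η* = ≈-sym (*-unique η (id-isAlgMorphism algK) identityˡ)

  isAlgMorphism∘* : ∀ {X Y Z} {k : K Y ⇒ K Z} {f : X ⇒ K Y} →
                    IsKAlgMorphism k → k ∘ f * ≈ (k ∘ f) *
  isAlgMorphism∘* {k = k} {f} k-mor =
    *-unique (k ∘ f) (∘-isAlgMorphism {α = algK} {algK} {algK} k-mor (*-isAlgMorphism f)) (≈-trans assoc (refl⟩∘⟨ *∘η f))

  *∘* : ∀ {X Y Z} {g : Y ⇒ K Z} {f : X ⇒ K Y} → g * ∘ f * ≈ (g * ∘ f) *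
  *∘* {g = g} = isAlgMorphism∘* (*-isAlgMorphism g)

  K₁∘η : ∀ {X Y} {f : X ⇒ Y} → K₁ f ∘ η ≈ η ∘ f
  K₁∘η {f = f} = *∘η (η ∘ f)

  K₁∘K₁ : ∀ {X Y Z} {g : Y ⇒ Z} {f : X ⇒ Y} → K₁ g ∘ K₁ f ≈ K₁ (g ∘ f)
  K₁∘K₁ {g = g} {f} = ≈-trans *∘* (*-cong (begin
    K₁ g ∘ η ∘ f   ≈⟨ sym-assoc ⟩
    (K₁ g ∘ η) ∘ f ≈⟨ K₁∘η ⟩∘⟨refl ⟩
    (η ∘ g) ∘ f    ≈⟨ assoc ⟩
    η ∘ g ∘ f      ∎))

  -- These are exactly the u for which ⟨ π₁ , u ⟩ is a morphism of the slice algebras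
  -- over A induced by K B and K C, so stability determines them by u ∘ (id ⁂ η).
  PreservesIteration : ∀ {A B C} → A × K B ⇒ K C → Set (o ⊔ ℓ ⊔ e)
  PreservesIteration {A} {B} u = ∀ {Z} (r : Z ⇒ A) (f : Z ⇒ (A × K B) + Z) → [ π₁ , r ] ∘ f ≈ r →
    u ∘ ⟨ r , ((π₂ +₁ id) ∘ f) † ⟩ ≈ ((u +₁ id) ∘ f) †

  IsInducedAlgMorphism : ∀ {A B C} → A × K B ⇒ A × K C → Set (o ⊔ ℓ ⊔ e)
  IsInducedAlgMorphism {B = B} {C} = IsSliceAlgMorphism (IsStable.inducedAlg (stable B))
                                                         (IsStable.inducedAlg (stable C))

  π₂∘-preservesIteration : ∀ {A B C} {h : A × K B ⇒ A × K C} →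
                           IsInducedAlgMorphism h → PreservesIteration (π₂ ∘ h)
  π₂∘-preservesIteration {h = h} (π₁∘h≈π₁ , h-mor) r f f-over = begin
    (π₂ ∘ h) ∘ ⟨ r , ((π₂ +₁ id) ∘ f) † ⟩                ≈⟨ assoc ⟩
    π₂ ∘ h ∘ ⟨ r , ((π₂ +₁ id) ∘ f) † ⟩                  ≈⟨ refl⟩∘⟨ h-mor r f f-over (over-+₁id π₁∘h≈π₁ f-over) ⟩
    π₂ ∘ ⟨ r , ((π₂ +₁ id) ∘ (h +₁ id) ∘ f) † ⟩          ≈⟨ project₂ ⟩
    ((π₂ +₁ id) ∘ (h +₁ id) ∘ f) †                       ≈⟨ †-cong algK +₁id∘+₁id ⟩
    ((π₂ ∘ h +₁ id) ∘ f) †                               ∎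

  ⟨π₁,-⟩-isInducedAlgMorphism : ∀ {A B C} {u : A × K B ⇒ K C} →
                                PreservesIteration u → IsInducedAlgMorphism ⟨ π₁ , u ⟩
  ⟨π₁,-⟩-isInducedAlgMorphism {u = u} u-pres = project₁ , λ r f f-over _ → begin
    ⟨ π₁ , u ⟩ ∘ ⟨ r , ((π₂ +₁ id) ∘ f) † ⟩              ≈⟨ ≈-trans ⟨⟩∘ (⟨⟩-cong project₁ (u-pres r f f-over)) ⟩
    ⟨ r , ((u +₁ id) ∘ f) † ⟩                            ≈⟨ ⟨⟩-cong ≈-refl (†-cong algK (≈-trans +₁id∘+₁id
                                                                (+₁-cong project₂ ≈-refl ⟩∘⟨refl))) ⟨
    ⟨ r , ((π₂ +₁ id) ∘ (⟨ π₁ , u ⟩ +₁ id) ∘ f) † ⟩      ∎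

  preservesIteration-unique : ∀ {A B C} {u v : A × K B ⇒ K C} →
    PreservesIteration u → PreservesIteration v → u ∘ (id ⁂ η) ≈ v ∘ (id ⁂ η) → u ≈ v
  preservesIteration-unique {A} {B} {C} {u} {v} u-pres v-pres u≈v = begin
    u                ≈⟨ project₂ ⟨
    π₂ ∘ ⟨ π₁ , u ⟩  ≈⟨ refl⟩∘⟨ ≈-trans (extension u-pres ≈-refl) (≈-sym (extension v-pres (≈-sym u≈v))) ⟩
    π₂ ∘ ⟨ π₁ , v ⟩  ≈⟨ project₂ ⟩
    v                ∎
    where
    free = IsStable.stableFree (stable B) {X = A} (IsStable.inducedAlg (stable C))
             ⟨ π₁ , u ∘ (id ⁂ η) ⟩ project₁

    extension : ∀ {w} → PreservesIteration w → w ∘ (id ⁂ η) ≈ u ∘ (id ⁂ η) →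
                ⟨ π₁ , w ⟩ ≈ proj₁ free
    extension {w} w-pres w≈u = proj₂ (proj₂ free) ⟨ π₁ , w ⟩ (⟨π₁,-⟩-isInducedAlgMorphism w-pres)
      (≈-trans ⟨⟩∘ (⟨⟩-cong (≈-trans project₁ identityˡ) w≈u))

  π₂-preservesIteration : ∀ {A B} → PreservesIteration (π₂ {A} {K B})
  π₂-preservesIteration r f f-over = project₂

  ∘-preservesIteration : ∀ {A B C D} {k : K C ⇒ K D} {u : A × K B ⇒ K C} →
                         IsKAlgMorphism k → PreservesIteration u → PreservesIteration (k ∘ u)
  ∘-preservesIteration {k = k} {u} k-mor u-pres r f f-over = begin
    (k ∘ u) ∘ ⟨ r , ((π₂ +₁ id) ∘ f) † ⟩  ≈⟨ assoc ⟩
    k ∘ u ∘ ⟨ r , ((π₂ +₁ id) ∘ f) † ⟩    ≈⟨ refl⟩∘⟨ u-pres r f f-over ⟩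
    k ∘ ((u +₁ id) ∘ f) †                  ≈⟨ k-mor _ ⟩
    ((k +₁ id) ∘ (u +₁ id) ∘ f) †          ≈⟨ †-cong algK +₁id∘+₁id ⟩
    ((k ∘ u +₁ id) ∘ f) †                  ∎

  ∘⟨π₁,-⟩-preservesIteration : ∀ {A B C D} {v : A × K C ⇒ K D} {u : A × K B ⇒ K C} →
    PreservesIteration v → PreservesIteration u → PreservesIteration (v ∘ ⟨ π₁ , u ⟩)
  ∘⟨π₁,-⟩-preservesIteration {v = v} {u} v-pres u-pres r f f-over = begin
    (v ∘ ⟨ π₁ , u ⟩) ∘ ⟨ r , ((π₂ +₁ id) ∘ f) † ⟩              ≈⟨ assoc ⟩
    v ∘ ⟨ π₁ , u ⟩ ∘ ⟨ r , ((π₂ +₁ id) ∘ f) † ⟩                ≈⟨ refl⟩∘⟨ ⟨π₁,u⟩-mor r f f-over f'-over ⟩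
    v ∘ ⟨ r , ((π₂ +₁ id) ∘ (⟨ π₁ , u ⟩ +₁ id) ∘ f) † ⟩        ≈⟨ v-pres r _ f'-over ⟩
    ((v +₁ id) ∘ (⟨ π₁ , u ⟩ +₁ id) ∘ f) †                     ≈⟨ †-cong algK +₁id∘+₁id ⟩
    ((v ∘ ⟨ π₁ , u ⟩ +₁ id) ∘ f) †                             ∎
    where
    ⟨π₁,u⟩-mor = proj₂ (⟨π₁,-⟩-isInducedAlgMorphism u-pres)
    f'-over = over-+₁id project₁ f-over

  module _ {A B : Obj} where
    private
      free = IsStable.stableFree (stable B) {X = A} (IsStable.inducedAlg (stable (A × B)))
               ⟨ π₁ , η ⟩ project₁

    τ∘id⁂η : τ {A} {B} ∘ (id ⁂ η) ≈ η
    τ∘id⁂η = ≈-trans assoc (≈-trans (refl⟩∘⟨ proj₂ (proj₁ (proj₂ free))) project₂)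

    τ-preservesIteration : PreservesIteration (τ {A} {B})
    τ-preservesIteration = π₂∘-preservesIteration (proj₁ (proj₁ (proj₂ free)))

  τ∘Δ-isAlgMorphism : ∀ {X} → IsKAlgMorphism (τ {K X} {X} ∘ Δ)
  τ∘Δ-isAlgMorphism f = begin
    (τ ∘ Δ) ∘ f †                          ≈⟨ assoc ⟩
    τ ∘ Δ ∘ f †                            ≈⟨ refl⟩∘⟨ Δ∘ ⟩
    τ ∘ ⟨ f † , f † ⟩                      ≈⟨ refl⟩∘⟨ ⟨⟩-cong ≈-refl (†-cong algK f≈π₂Δf) ⟩
    τ ∘ ⟨ f † , ((π₂ +₁ id) ∘ Δf) † ⟩      ≈⟨ τ-preservesIteration (f †) Δf Δf-over ⟩
    ((τ +₁ id) ∘ Δf) †                     ≈⟨ †-cong algK +₁id∘+₁id ⟩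
    ((τ ∘ Δ +₁ id) ∘ f) †                  ∎
    where
    Δf = (Δ +₁ id) ∘ f
    Δf-over = over-+₁id project₁ (≈-sym (IterationAlgebra.fixpoint algK))
    f≈π₂Δf = ≈-sym (begin
      (π₂ +₁ id) ∘ Δf     ≈⟨ +₁id∘+₁id ⟩
      (π₂ ∘ Δ +₁ id) ∘ f  ≈⟨ ≈-trans (+₁-cong project₂ ≈-refl) id+₁id ⟩∘⟨refl ⟩
      id ∘ f              ≈⟨ identityˡ ⟩
      f                   ∎)

  τ∘Δ≈K₁⟨η,id⟩ : ∀ {X} → τ {K X} {X} ∘ Δ ≈ K₁ ⟨ η , id ⟩
  τ∘Δ≈K₁⟨η,id⟩ = *-unique _ τ∘Δ-isAlgMorphism (begin
    (τ ∘ Δ) ∘ η              ≈⟨ assoc ⟩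
    τ ∘ Δ ∘ η                ≈⟨ refl⟩∘⟨ ≈-trans Δ∘ (≈-sym (≈-trans ⁂∘⟨⟩ (⟨⟩-cong identityˡ identityʳ))) ⟩
    τ ∘ (id ⁂ η) ∘ ⟨ η , id ⟩ ≈⟨ sym-assoc ⟩
    (τ ∘ (id ⁂ η)) ∘ ⟨ η , id ⟩ ≈⟨ τ∘id⁂η ⟩∘⟨refl ⟩
    η ∘ ⟨ η , id ⟩           ∎)

  τ̂∘η⁂id : ∀ {A B} → τ̂ {A} {B} ∘ (η ⁂ id) ≈ η
  τ̂∘η⁂id = begin
    (K₁ swap ∘ τ ∘ swap) ∘ (η ⁂ id)    ≈⟨ ≈-trans assoc (refl⟩∘⟨ assoc) ⟩
    K₁ swap ∘ τ ∘ swap ∘ (η ⁂ id)      ≈⟨ refl⟩∘⟨ refl⟩∘⟨ swap∘⁂ ⟩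
    K₁ swap ∘ τ ∘ (id ⁂ η) ∘ swap      ≈⟨ refl⟩∘⟨ ≈-trans sym-assoc (τ∘id⁂η ⟩∘⟨refl) ⟩
    K₁ swap ∘ η ∘ swap                 ≈⟨ ≈-trans sym-assoc (K₁∘η ⟩∘⟨refl) ⟩
    (η ∘ swap) ∘ swap                  ≈⟨ ≈-trans assoc (refl⟩∘⟨ swap∘swap) ⟩
    η ∘ id                             ≈⟨ identityʳ ⟩
    η                                  ∎

  τ̂*∘τ∘Δ≈K₁Δ : ∀ {X} → τ̂ * ∘ τ ∘ Δ ≈ K₁ (Δ {X})
  τ̂*∘τ∘Δ≈K₁Δ = begin
    τ̂ * ∘ τ ∘ Δ                  ≈⟨ refl⟩∘⟨ τ∘Δ≈K₁⟨η,id⟩ ⟩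
    τ̂ * ∘ K₁ ⟨ η , id ⟩          ≈⟨ *∘* ⟩
    (τ̂ * ∘ η ∘ ⟨ η , id ⟩) *      ≈⟨ *-cong (≈-trans sym-assoc (*∘η τ̂ ⟩∘⟨refl)) ⟩
    (τ̂ ∘ ⟨ η , id ⟩) *            ≈⟨ *-cong (refl⟩∘⟨ ⁂∘Δ) ⟨
    (τ̂ ∘ (η ⁂ id) ∘ Δ) *          ≈⟨ *-cong (≈-trans sym-assoc (τ̂∘η⁂id ⟩∘⟨refl)) ⟩
    K₁ Δ                         ∎

  K₁π₂∘τ≈π₂ : ∀ {A B} → K₁ (π₂ {A} {B}) ∘ τ ≈ π₂
  K₁π₂∘τ≈π₂ = preservesIteration-unique
    (∘-preservesIteration (*-isAlgMorphism _) τ-preservesIteration) π₂-preservesIteration (begin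
      (K₁ π₂ ∘ τ) ∘ (id ⁂ η)  ≈⟨ ≈-trans assoc (refl⟩∘⟨ τ∘id⁂η) ⟩
      K₁ π₂ ∘ η               ≈⟨ K₁∘η ⟩
      η ∘ π₂                  ≈⟨ project₂ ⟨
      π₂ ∘ (id ⁂ η)           ∎)

  K₁π₁∘τ̂≈π₁ : ∀ {A B} → K₁ (π₁ {A} {B}) ∘ τ̂ ≈ π₁
  K₁π₁∘τ̂≈π₁ = begin
    K₁ π₁ ∘ K₁ swap ∘ τ ∘ swap   ≈⟨ sym-assoc ⟩
    (K₁ π₁ ∘ K₁ swap) ∘ τ ∘ swap ≈⟨ ≈-trans K₁∘K₁ (*-cong (refl⟩∘⟨ project₁)) ⟩∘⟨refl ⟩
    K₁ π₂ ∘ τ ∘ swap             ≈⟨ ≈-trans sym-assoc (K₁π₂∘τ≈π₂ ⟩∘⟨refl) ⟩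
    π₂ ∘ swap                    ≈⟨ project₂ ⟩
    π₁                           ∎

  K₁π₁∘τ̂*≈π₁* : ∀ {A B} → K₁ (π₁ {A} {B}) ∘ τ̂ * ≈ π₁ *
  K₁π₁∘τ̂*≈π₁* = ≈-trans (isAlgMorphism∘* (*-isAlgMorphism _)) (*-cong K₁π₁∘τ̂≈π₁)

  π₁*∘K₁⟨η,id⟩≈id : ∀ {X} → (π₁ {K X} {X}) * ∘ K₁ ⟨ η , id ⟩ ≈ id
  π₁*∘K₁⟨η,id⟩≈id = begin
    π₁ * ∘ K₁ ⟨ η , id ⟩       ≈⟨ *∘* ⟩
    (π₁ * ∘ η ∘ ⟨ η , id ⟩) *  ≈⟨ *-cong (≈-trans sym-assoc (*∘η π₁ ⟩∘⟨refl)) ⟩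
    (π₁ ∘ ⟨ η , id ⟩) *        ≈⟨ *-cong project₁ ⟩
    η *                        ≈⟨ η* ⟩
    id                         ∎

  π₁*∘τ⊑π₁ : ∀ {Y Z} → (π₁ {K Y} {Z}) * ∘ τ ⊑ π₁
  π₁*∘τ⊑π₁ = preservesIteration-unique
    (∘-preservesIteration (*-isAlgMorphism π₁) τ-preservesIteration)
    (∘-preservesIteration (*-isAlgMorphism π₁)
      (∘⟨π₁,-⟩-preservesIteration τ-preservesIteration
        (∘-preservesIteration (*-isAlgMorphism π₁) τ-preservesIteration)))
    (≈-trans restrict (≈-sym (begin
      (π₁ * ∘ τ ∘ ⟨ π₁ , π₁ * ∘ τ ⟩) ∘ (id ⁂ η)  ≈⟨ ≈-trans assoc (refl⟩∘⟨ assoc) ⟩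
      π₁ * ∘ τ ∘ ⟨ π₁ , π₁ * ∘ τ ⟩ ∘ (id ⁂ η)    ≈⟨ refl⟩∘⟨ refl⟩∘⟨ ≈-trans ⟨⟩∘ (⟨⟩-cong (≈-trans project₁ identityˡ) restrict) ⟩
      π₁ * ∘ τ ∘ ⟨ π₁ , π₁ ⟩                     ≈⟨ refl⟩∘⟨ refl⟩∘⟨ Δ∘ ⟨
      π₁ * ∘ τ ∘ Δ ∘ π₁                          ≈⟨ refl⟩∘⟨ ≈-trans sym-assoc (τ∘Δ≈K₁⟨η,id⟩ ⟩∘⟨refl) ⟩
      π₁ * ∘ K₁ ⟨ η , id ⟩ ∘ π₁                  ≈⟨ ≈-trans sym-assoc (π₁*∘K₁⟨η,id⟩≈id ⟩∘⟨refl) ⟩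
      id ∘ π₁                                    ≈⟨ identityˡ ⟩
      π₁                                         ∎)))
    where
    restrict : (π₁ * ∘ τ) ∘ (id ⁂ η) ≈ π₁
    restrict = ≈-trans assoc (≈-trans (refl⟩∘⟨ τ∘id⁂η) (*∘η π₁))

  ↓-cong : ∀ {X Y Z} {f f' : X ⇒ K Y} {g g' : X ⇒ K Z} → f ≈ f' → g ≈ g' → f ↓ g ≈ f' ↓ g'
  ↓-cong f≈f' g≈g' = refl⟩∘⟨ refl⟩∘⟨ ⟨⟩-cong f≈f' g≈g'

  ↓-∘ : ∀ {W X Y Z} {f : X ⇒ K Y} {g : X ⇒ K Z} {h : W ⇒ X} → (f ↓ g) ∘ h ≈ (f ∘ h) ↓ (g ∘ h)
  ↓-∘ = ≈-trans assoc (refl⟩∘⟨ ≈-trans assoc (refl⟩∘⟨ ⟨⟩∘))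

  ↓-⊑ : ∀ {X Y Z} (f : X ⇒ K Y) (g : X ⇒ K Z) → f ↓ g ⊑ f
  ↓-⊑ f g = begin
    f ↓ g                                        ≈⟨ ≈-sym assoc ⟩
    (π₁ * ∘ τ) ∘ ⟨ f , g ⟩                        ≈⟨ π₁*∘τ⊑π₁ ⟩∘⟨refl ⟩
    (π₁ ↓ (π₁ * ∘ τ)) ∘ ⟨ f , g ⟩                 ≈⟨ ↓-∘ ⟩
    (π₁ ∘ ⟨ f , g ⟩) ↓ ((π₁ * ∘ τ) ∘ ⟨ f , g ⟩)   ≈⟨ ↓-cong project₁ assoc ⟩
    f ↓ (f ↓ g)                                  ∎

  K₁π₁∘τ̂*∘τ∘⟨⟩≈↓ : ∀ {X Y Z} {f : X ⇒ K Y} {g : X ⇒ K Z} → K₁ π₁ ∘ τ̂ * ∘ τ ∘ ⟨ f , g ⟩ ≈ f ↓ g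
  K₁π₁∘τ̂*∘τ∘⟨⟩≈↓ = ≈-trans sym-assoc (K₁π₁∘τ̂*≈π₁* ⟩∘⟨refl)

proposition5p13 : ∀ {o ℓ e} (S : Setting o ℓ e) (H : Iteration.StableFreeIteration S) →
    let open Setting S
        open Monad S H
    in (∀ {X : Obj} → (τ̂ *) ∘ τ ∘ Δ ≈ K₁ (Δ {X}))
       ∧ (∀ {X Y Z : Obj} (f : X ⇒ K Y) (g : X ⇒ K Z) → K₁ π₁ ∘ (τ̂ *) ∘ τ ∘ ⟨ f , g ⟩ ⊑ f)
proposition5p13 S H = τ̂*∘τ∘Δ≈K₁Δ , weaklyDiscardable
  where
  open Setting S
  open Monad S H
  open MonadProperties S H
  open HomReasoning cat

  weaklyDiscardable : ∀ {X Y Z} (f : X ⇒ K Y) (g : X ⇒ K Z) → K₁ π₁ ∘ τ̂ * ∘ τ ∘ ⟨ f , g ⟩ ⊑ f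
  weaklyDiscardable f g = begin
    K₁ π₁ ∘ τ̂ * ∘ τ ∘ ⟨ f , g ⟩        ≈⟨ K₁π₁∘τ̂*∘τ∘⟨⟩≈↓ ⟩
    f ↓ g                              ≈⟨ ↓-⊑ f g ⟩
    f ↓ (f ↓ g)                        ≈⟨ ↓-cong ≈-refl K₁π₁∘τ̂*∘τ∘⟨⟩≈↓ ⟨
    f ↓ (K₁ π₁ ∘ τ̂ * ∘ τ ∘ ⟨ f , g ⟩)  ∎
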